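{- Let $m=5^k$ with $k\in\mathbb{N}$, $k\geq1$. Then there exists an integer $a$ with $1\leq a<m$ and $\gcd(a,5)=1$ such that $K_{\mathbb{C}}(a/m)\leq 7$.
   Context: For $z\in\mathbb{C}$, $[z]:=\lfloor \mathrm{Re}(z)+\tfrac12\rfloor+i\lfloor \mathrm{Im}(z)+\tfrac12\rfloor$. Let $\mathfrak{F}=\{z\in\mathbb{C}: -\tfrac12\leq\mathrm{Re}(z)<\tfrac12,\ -\tfrac12\leq\mathrm{Im}(z)<\tfrac12\}$ and $T:\mathfrak{F}\to\mathfrak{F}$, $T(z)=z^{ -1}-[z^{ -1}]$ for $z\neq0$, $T(0)=0$. For $z\in\mathfrak{F}\setminus\{0\}$, $a_1(z)=[z^{ -1}]$ and, while $T^{n-1}(z)\neq0$, $a_n(z)=a_1(T^{n-1}(z))$. For general $z\in\mathbb{C}$, $a_0(z)=[z]$ and $a_n(z)=a_n(z-a_0(z))$ for $n\geq1$. For $z\in\mathbb{Q}(i)$ the sequence terminates, giving the Hurwitz continued fraction $[a_0(z);a_1(z),\ldots,a_n(z)]_{\mathbb{C}}$, and $K_{\mathbb{C}}(z):=\max(|a_1(z)|,\ldots,|a_n(z)|)$ (the term $a_0$ is not included). -}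

module Defs where

open import Data.Nat as ℕ using (ℕ; zero; suc)
open import Data.Integer as ℤ using (ℤ; +_; _/ℕ_)
open import Data.Product using (_×_; _,_; proj₁; proj₂)
open import Data.List using (List; []; _∷_)
open import Data.Maybe using (Maybe; just; nothing)

ℤ[i] : Set
ℤ[i] = ℤ × ℤ

re im : ℤ[i] → ℤ
re = proj₁
im = proj₂

_+ᵍ_ _-ᵍ_ _*ᵍ_ : ℤ[i] → ℤ[i] → ℤ[i]
(a , b) +ᵍ (c , d) = (a ℤ.+ c , b ℤ.+ d)
(a , b) -ᵍ (c , d) = (a ℤ.- c , b ℤ.- d)
(a , b) *ᵍ (c , d) = (a ℤ.* c ℤ.- b ℤ.* d , a ℤ.* d ℤ.+ b ℤ.* c)

conj : ℤ[i] → ℤ[i]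
conj (a , b) = (a , ℤ.- b)

norm : ℤ[i] → ℕ
norm (a , b) = ℤ.∣ a ∣ ℕ.* ℤ.∣ a ∣ ℕ.+ ℤ.∣ b ∣ ℕ.* ℤ.∣ b ∣

-- ⌊ n / d ⌋ for d > 0 (floor division; the value at d = 0 is irrelevant).
floorDiv : ℤ → ℕ → ℤ
floorDiv n zero    = + 0
floorDiv n (suc k) = n /ℕ suc k

-- ⌊ r / D + 1/2 ⌋ = ⌊ (2 r + D) / (2 D) ⌋ for D > 0.
roundHalf : ℤ → ℕ → ℤ
roundHalf r D = floorDiv (+ 2 ℤ.* r ℤ.+ + D) (2 ℕ.* D)

-- [p / q] for Gaussian integers p, q with q ≠ 0, where
-- [z] = ⌊Re z + 1/2⌋ + i ⌊Im z + 1/2⌋.  Uses p / q = p·conj(q) / N(q).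
nearest : ℤ[i] → ℤ[i] → ℤ[i]
nearest p q = let w = p *ᵍ conj q in
  (roundHalf (re w) (norm q) , roundHalf (im w) (norm q))

-- Hurwitz algorithm on a fractional part z = num / den ∈ 𝔉 (den ≠ 0),
-- with a fuel bound.
-- One step: a = [1/z] = [den/num], T(z) = 1/z - a = (den - a·num)/num.
hurwitzTail : ℕ → ℤ[i] → ℤ[i] → Maybe (List ℤ[i])
hurwitzTail fuel num den with norm num
... | zero = just []
hurwitzTail zero    num den | suc _ = nothing
hurwitzTail (suc f) num den | suc _ with nearest den num
... | a with hurwitzTail f (den -ᵍ (a *ᵍ num)) num
...   | nothing = nothing
...   | just ds = just (a ∷ ds)

-- Digits a₁(z), …, aₙ(z) of z = p / q (q ≠ 0): first a₀ = [z] is removed,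
-- z - a₀ = (p - a₀ q) / q, and the tail algorithm is run on that.
hurwitzDigits : ℕ → ℤ[i] → ℤ[i] → Maybe (List ℤ[i])
hurwitzDigits fuel p q = hurwitzTail fuel (p -ᵍ (nearest p q *ᵍ q)) q

ofℕ : ℕ → ℤ[i]
ofℕ n = (+ n , + 0)

-- A string of integer digits D = [x₁, …, xₙ] is encoded by the continuant matrix
-- S(x₁) ⋯ S(xₙ), S(x) = (0 1; 1 x), whose second column (b, d) has b / d = [0; x₁, …, xₙ].
-- If every |xᵢ| ≥ 3 then |b / d| ≤ 2/5 < 1/2 for every tail of D, so the nearest-integer
-- (Hurwitz) algorithm recovers D from the fraction a / |d| with a ≡ ±b (mod d), and a is
-- prime to d because the matrix is unimodular.  It remains to find digit strings in [3, 7]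
-- with |d| = 5^k.  Two folding operations turn a string for 5^k into strings for 5^(2k+1)
-- and 5^(2k): append 5 and the reversed negated string, or replace the last digit l by
-- l + 1, l − 1 and append the reversed remaining string.  Starting from [5] and following
-- the binary expansion of k reaches every k ≥ 1.

module Submission where

-- The ring solver is used only where the constructors of All are not in scope: with
-- them, its variable lists (built with _∷_) become ambiguous.
module Continuants where

  open import Data.Integer.Base as ℤ
    using (ℤ; +_; -[1+_]; 0ℤ; 1ℤ; -1ℤ; _+_; _-_; _*_; -_; ∣_∣)
  import Data.Integer.Properties as ℤ
  import Data.Integer.DivMod as ℤ
  import Data.Integer.Divisibility.Signed as ℤ
  open import Data.Integer.Tactic.RingSolver using (solve)
  open import Data.List.Base using (List; []; _∷_; _++_; [_])
  open import Data.Maybe.Base using (just)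
  open import Data.Nat.Base as ℕ using (ℕ; zero; suc; _≤_; _<_; s≤s; z≤n)
  import Data.Nat.Properties as ℕ
  import Data.Nat.Tactic.RingSolver as ℕ
  open import Data.Nat.Coprimality using (Coprime)
  import Data.Nat.Divisibility as ℕ
  open import Data.Product.Base using (∃; ∃₂; _×_; _,_; proj₁; proj₂)
  open import Relation.Binary.Definitions using (tri<; tri≈; tri>)
  open import Relation.Binary.PropositionalEquality
    using (_≡_; _≢_; refl; sym; trans; cong; cong₂; subst; subst₂; module ≡-Reasoning)
  open import Relation.Nullary.Decidable using (Dec; _×-dec_)
  open import Relation.Nullary.Negation using (contradiction)
  open import Defs

  record Mat : Set where
    no-eta-equality
    pattern
    constructor mk
    field a b c d : ℤ

  mk-cong : ∀ {a b c d a′ b′ c′ d′} → a ≡ a′ → b ≡ b′ → c ≡ c′ → d ≡ d′ →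
            mk a b c d ≡ mk a′ b′ c′ d′
  mk-cong refl refl refl refl = refl

  infixr 7 _⊗_
  infixr 6 _◂_

  _⊗_ : Mat → Mat → Mat
  mk a b c d ⊗ mk p q r s =
    mk (a * p + b * r) (a * q + b * s) (c * p + d * r) (c * q + d * s)

  I : Mat
  I = mk 1ℤ 0ℤ 0ℤ 1ℤ

  S : ℤ → Mat
  S x = mk 0ℤ 1ℤ 1ℤ x

  _◂_ : ℤ → Mat → Mat
  x ◂ mk a b c d = mk c d (a + x * c) (b + x * d)

  det : Mat → ℤ
  det (mk a b c d) = a * d - b * c

  mat : List ℤ → Mat
  mat []      = I
  mat (x ∷ D) = x ◂ mat D

  ◂-b : ∀ x M → Mat.b (x ◂ M) ≡ Mat.d M
  ◂-b x (mk a b c d) = refl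

  ◂-⊗ : ∀ x M N → x ◂ M ⊗ N ≡ (x ◂ M) ⊗ N
  ◂-⊗ x (mk a b c d) (mk p q r s) = mk-cong refl refl
    (solve (x ∷ a ∷ b ∷ c ∷ d ∷ p ∷ q ∷ r ∷ s ∷ []))
    (solve (x ∷ a ∷ b ∷ c ∷ d ∷ p ∷ q ∷ r ∷ s ∷ []))

  I-⊗ : ∀ M → I ⊗ M ≡ M
  I-⊗ (mk p q r s) = mk-cong
    (solve (p ∷ r ∷ [])) (solve (q ∷ s ∷ [])) (solve (p ∷ r ∷ [])) (solve (q ∷ s ∷ []))

  mat-++ : ∀ D E → mat (D ++ E) ≡ mat D ⊗ mat E
  mat-++ []      E = sym (I-⊗ (mat E))
  mat-++ (x ∷ D) E = trans (cong (x ◂_) (mat-++ D E)) (◂-⊗ x (mat D) (mat E))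

  mat-[x] : ∀ x → mat [ x ] ≡ S x
  mat-[x] x = mk-cong refl refl (solve (x ∷ [])) (solve (x ∷ []))

  det-◂ : ∀ x M → det (x ◂ M) ≡ - det M
  det-◂ x (mk a b c d) = begin
    c * (b + x * d) - d * (a + x * c) ≡⟨ solve (x ∷ a ∷ b ∷ c ∷ d ∷ []) ⟩
    - (a * d - b * c)                 ∎
    where open ≡-Reasoning

  ∣det-mat∣ : ∀ D → ∣ det (mat D) ∣ ≡ 1
  ∣det-mat∣ []      = refl
  ∣det-mat∣ (x ∷ D) = begin
    ∣ det (x ◂ mat D) ∣ ≡⟨ cong ∣_∣ (det-◂ x (mat D)) ⟩
    ∣ - det (mat D) ∣   ≡⟨ ℤ.∣-i∣≡∣i∣ (det (mat D)) ⟩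
    ∣ det (mat D) ∣     ≡⟨ ∣det-mat∣ D ⟩
    1                   ∎
    where open ≡-Reasoning

  -- fold₅ D = D ++ 5 ∷ reverse (map -_ D), and foldEven x D replaces the last digit l of
  -- x ∷ D by l + 1, l - 1 and appends the reverse of the other digits.  For the matrix M of
  -- the string and δ = det M = ±1 the folded strings have the matrices M S(5) J M⁻¹ J and
  -- M′ S(l + 1) S(l - 1) M′ᵀ, with J = (0 1; 1 0) and M′ = M S(l)⁻¹; multiplied out, these
  -- only depend on δ and the second column of M.

  fold₅ : List ℤ → List ℤ
  fold₅ []      = [ + 5 ]
  fold₅ (x ∷ D) = x ∷ fold₅ D ++ [ - x ]

  foldEven : ℤ → List ℤ → List ℤ
  foldEven x []      = x + 1ℤ ∷ [ x - 1ℤ ]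
  foldEven x (y ∷ D) = x ∷ foldEven y D ++ [ x ]

  fold₅Mat : ℤ → Mat → Mat
  fold₅Mat δ (mk _ b _ d) = mk (δ * - (+ 5 * (b * b))) (δ * (δ + + 5 * (b * d)))
                               (δ * (δ - + 5 * (b * d))) (δ * (+ 5 * (d * d)))

  foldEvenMat : ℤ → Mat → Mat
  foldEvenMat δ (mk _ b _ d) = mk (b * b) (b * d + δ) (b * d - δ) (d * d)

  fold₅Mat-d : ∀ δ M → Mat.d (fold₅Mat δ M) ≡ δ * (+ 5 * (Mat.d M * Mat.d M))
  fold₅Mat-d δ (mk _ _ _ _) = refl

  foldEvenMat-d : ∀ δ M → Mat.d (foldEvenMat δ M) ≡ Mat.d M * Mat.d M
  foldEvenMat-d δ (mk _ _ _ _) = refl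

  fold₅Mat-◂ : ∀ δ x M → fold₅Mat (- δ) (x ◂ M) ≡ x ◂ fold₅Mat δ M ⊗ S (- x)
  fold₅Mat-◂ δ x (mk a b c d) = mk-cong
    (solve (δ ∷ x ∷ b ∷ d ∷ [])) (solve (δ ∷ x ∷ b ∷ d ∷ []))
    (solve (δ ∷ x ∷ b ∷ d ∷ [])) (solve (δ ∷ x ∷ b ∷ d ∷ []))

  foldEvenMat-◂ : ∀ δ x M → foldEvenMat (- δ) (x ◂ M) ≡ x ◂ foldEvenMat δ M ⊗ S x
  foldEvenMat-◂ δ x (mk a b c d) = mk-cong
    (solve (δ ∷ x ∷ b ∷ d ∷ [])) (solve (δ ∷ x ∷ b ∷ d ∷ []))
    (solve (δ ∷ x ∷ b ∷ d ∷ [])) (solve (δ ∷ x ∷ b ∷ d ∷ []))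

  mat-fold₅ : ∀ D → mat (fold₅ D) ≡ fold₅Mat (det (mat D)) (mat D)
  mat-fold₅ []      = refl
  mat-fold₅ (x ∷ D) = begin
    x ◂ mat (fold₅ D ++ [ - x ])     ≡⟨ cong (x ◂_) (mat-++ (fold₅ D) [ - x ]) ⟩
    x ◂ mat (fold₅ D) ⊗ mat [ - x ]  ≡⟨ cong₂ (λ N P → x ◂ N ⊗ P) (mat-fold₅ D) (mat-[x] (- x)) ⟩
    x ◂ fold₅Mat (det M) M ⊗ S (- x) ≡⟨ fold₅Mat-◂ (det M) x M ⟨
    fold₅Mat (- det M) (x ◂ M)       ≡⟨ cong (λ δ → fold₅Mat δ (x ◂ M)) (det-◂ x M) ⟨
    fold₅Mat (det (x ◂ M)) (x ◂ M)   ∎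
    where
    open ≡-Reasoning
    M = mat D

  mat-foldEven : ∀ x D → mat (foldEven x D) ≡ foldEvenMat (det (mat (x ∷ D))) (mat (x ∷ D))
  mat-foldEven x []      = begin
    mat (x + 1ℤ ∷ [ x - 1ℤ ])         ≡⟨ mk-cong (solve (x ∷ [])) (solve (x ∷ []))
                                                 (solve (x ∷ [])) (solve (x ∷ [])) ⟩
    foldEvenMat (- det I) (x ◂ I)     ≡⟨ cong (λ δ → foldEvenMat δ (x ◂ I)) (det-◂ x I) ⟨
    foldEvenMat (det (x ◂ I)) (x ◂ I) ∎
    where open ≡-Reasoning
  mat-foldEven x (y ∷ D) = begin
    x ◂ mat (foldEven y D ++ [ x ])    ≡⟨ cong (x ◂_) (mat-++ (foldEven y D) [ x ]) ⟩
    x ◂ mat (foldEven y D) ⊗ mat [ x ] ≡⟨ cong₂ (λ N P → x ◂ N ⊗ P) (mat-foldEven y D) (mat-[x] x) ⟩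
    x ◂ foldEvenMat (det M) M ⊗ S x    ≡⟨ foldEvenMat-◂ (det M) x M ⟨
    foldEvenMat (- det M) (x ◂ M)      ≡⟨ cong (λ δ → foldEvenMat δ (x ◂ M)) (det-◂ x M) ⟨
    foldEvenMat (det (x ◂ M)) (x ◂ M)  ∎
    where
    open ≡-Reasoning
    M = mat (y ∷ D)

  -- The nearest-integer algorithm on real fractions

  real : ℤ → ℤ[i]
  real x = (x , 0ℤ)

  floorDiv-unique : ∀ x q r N → r < N → x ≡ q * + N + + r → floorDiv x N ≡ q
  floorDiv-unique x q r N@(suc _) r<N x≡ with ℤ.<-cmp (x ℤ./ℕ N) q
  ... | tri≈ _ x/N≡q _ = x/N≡q
  ... | tri< x/N<q _ _ = contradiction (begin-strict
    x                      <⟨ ℤ.n<s[n/ℕd]*d x N ⟩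
    ℤ.suc (x ℤ./ℕ N) * + N ≤⟨ ℤ.*-monoʳ-≤-nonNeg (+ N) (ℤ.i<j⇒suc[i]≤j x/N<q) ⟩
    q * + N                ≤⟨ ℤ.i≤i+j (q * + N) (+ r) ⟩
    q * + N + + r          ≡⟨ x≡ ⟨
    x                      ∎) (ℤ.<-irrefl refl)
    where open ℤ.≤-Reasoning
  ... | tri> _ _ q<x/N = contradiction (begin-strict
    x                      ≡⟨ x≡ ⟩
    q * + N + + r          <⟨ ℤ.+-monoʳ-< (q * + N) (ℤ.+<+ r<N) ⟩
    q * + N + + N          ≡⟨ ℤ.+-comm (q * + N) (+ N) ⟩
    + N + q * + N          ≡⟨ ℤ.suc-* q (+ N) ⟨
    ℤ.suc q * + N          ≤⟨ ℤ.*-monoʳ-≤-nonNeg (+ N) (ℤ.i<j⇒suc[i]≤j q<x/N) ⟩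
    (x ℤ./ℕ N) * + N       ≤⟨ ℤ.[n/ℕd]*d≤n x N ⟩
    x                      ∎) (ℤ.<-irrefl refl)
    where open ℤ.≤-Reasoning

  half-offset : ∀ u N → 2 ℕ.* ∣ u ∣ < N → ∃ λ r → r < N ℕ.+ N × + 2 * u + + N ≡ + r
  half-offset (+ n)    N 2n<N =
    2 ℕ.* n ℕ.+ N , ℕ.+-monoˡ-< N 2n<N , cong (_+ + N) (sym (ℤ.pos-* 2 n))
  half-offset -[1+ n ] N 2n<N =
    N ℕ.∸ 2 ℕ.* suc n ,
    ℕ.≤-<-trans (ℕ.m∸n≤m N (2 ℕ.* suc n)) (ℕ.m<m+n N (ℕ.≤-<-trans z≤n 2n<N)) ,
    ℤ.⊖-≥ (ℕ.<⇒≤ 2n<N)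

  roundHalf-unique : ∀ x u N → 2 ℕ.* ∣ u ∣ < N → roundHalf (x * + N + u) N ≡ x
  roundHalf-unique x u N 2∣u∣<N with half-offset u N 2∣u∣<N
  ... | r , r<N+N , 2u+N≡r =
    floorDiv-unique _ x r (2 ℕ.* N) (subst (r <_) N+N≡2N r<N+N) (begin
      + 2 * (x * + N + u) + + N         ≡⟨ shift (+ N) ⟩
      x * (+ 2 * + N) + (+ 2 * u + + N) ≡⟨ cong₂ (λ m n → x * m + n) (ℤ.pos-* 2 N) (sym 2u+N≡r) ⟨
      x * + (2 ℕ.* N) + + r             ∎)
    where
    open ≡-Reasoning
    N+N≡2N : N ℕ.+ N ≡ 2 ℕ.* N
    N+N≡2N = cong (N ℕ.+_) (sym (ℕ.+-identityʳ N))
    shift : ∀ n → + 2 * (x * n + u) + n ≡ x * (+ 2 * n) + (+ 2 * u + n)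
    shift n = solve (x ∷ u ∷ n ∷ [])

  +∣i∣*∣i∣≡i*i : ∀ i → + (∣ i ∣ ℕ.* ∣ i ∣) ≡ i * i
  +∣i∣*∣i∣≡i*i (+ n)    = ℤ.pos-* n n
  +∣i∣*∣i∣≡i*i -[1+ n ] = refl

  nearest-real : ∀ x b d → 2 ℕ.* ∣ b ∣ < ∣ d ∣ → nearest (real (b + x * d)) (real d) ≡ real x
  nearest-real x b d 2∣b∣<∣d∣ = cong₂ _,_
    (trans (cong (λ w → roundHalf w N) real-part) (roundHalf-unique x (b * d) N 2∣bd∣<N))
    (trans (cong (λ w → roundHalf w N) imaginary-part)
           (roundHalf-unique 0ℤ 0ℤ N (ℕ.≤-<-trans z≤n 2∣bd∣<N)))
    where
    N = ∣ d ∣ ℕ.* ∣ d ∣ ℕ.+ 0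
    +N≡d*d : + N ≡ d * d
    +N≡d*d = trans (cong +_ (ℕ.+-identityʳ _)) (+∣i∣*∣i∣≡i*i d)
    real-part : (b + x * d) * d - 0ℤ * 0ℤ ≡ x * + N + b * d
    real-part = begin
      (b + x * d) * d - 0ℤ * 0ℤ ≡⟨ solve (x ∷ b ∷ d ∷ []) ⟩
      x * (d * d) + b * d       ≡⟨ cong (λ n → x * n + b * d) +N≡d*d ⟨
      x * + N + b * d           ∎
      where open ≡-Reasoning
    imaginary-part : (b + x * d) * 0ℤ + 0ℤ * d ≡ 0ℤ
    imaginary-part = solve (x ∷ b ∷ d ∷ [])
    0<∣d∣ = ℕ.≤-<-trans z≤n 2∣b∣<∣d∣
    2∣bd∣<N : 2 ℕ.* ∣ b * d ∣ < N
    2∣bd∣<N = begin-strict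
      2 ℕ.* ∣ b * d ∣         ≡⟨ cong (2 ℕ.*_) (ℤ.abs-* b d) ⟩
      2 ℕ.* (∣ b ∣ ℕ.* ∣ d ∣) ≡⟨ ℕ.*-assoc 2 ∣ b ∣ ∣ d ∣ ⟨
      2 ℕ.* ∣ b ∣ ℕ.* ∣ d ∣   <⟨ ℕ.*-monoˡ-< ∣ d ∣ {{ℕ.>-nonZero 0<∣d∣}} 2∣b∣<∣d∣ ⟩
      ∣ d ∣ ℕ.* ∣ d ∣         ≤⟨ ℕ.m≤m+n _ 0 ⟩
      N                       ∎
      where open ℕ.≤-Reasoning

  hurwitzTail-step : ∀ {f v den ds} → v ≢ 0ℤ →
    hurwitzTail f (den -ᵍ (nearest den (real v) *ᵍ real v)) (real v) ≡ just ds →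
    hurwitzTail (suc f) (real v) den ≡ just (nearest den (real v) ∷ ds)
  hurwitzTail-step {v = + zero} v≢0 _ = contradiction refl v≢0
  -- Splitting v lets norm (real v) reduce to a successor.
  hurwitzTail-step {f} {v@(+ suc _)} {den} _ tail
    with hurwitzTail f (den -ᵍ (nearest den (real v) *ᵍ real v)) (real v) | tail
  ... | just _ | refl = refl
  hurwitzTail-step {f} {v@(-[1+ _ ])} {den} _ tail
    with hurwitzTail f (den -ᵍ (nearest den (real v) *ᵍ real v)) (real v) | tail
  ... | just _ | refl = refl

  real-cancel : ∀ u x v → real (u + x * v) -ᵍ (real x *ᵍ real v) ≡ real u
  real-cancel u x v = cong₂ _,_ real-part imaginary-part
    where
    real-part : u + x * v - (x * v - 0ℤ * 0ℤ) ≡ u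
    real-part = solve (u ∷ x ∷ v ∷ [])
    imaginary-part : 0ℤ - (x * 0ℤ + 0ℤ * v) ≡ 0ℤ
    imaginary-part = solve (x ∷ v ∷ [])

  hurwitzDigits-real : ∀ f t x v → 2 ℕ.* ∣ t ∣ < ∣ v ∣ →
    hurwitzDigits f (real (t + x * v)) (real v) ≡ hurwitzTail f (real t) (real v)
  hurwitzDigits-real f t x v 2∣t∣<∣v∣ = begin
    hurwitzTail f (p -ᵍ (nearest p (real v) *ᵍ real v)) (real v)
      ≡⟨ cong (λ a → hurwitzTail f (p -ᵍ (a *ᵍ real v)) (real v)) (nearest-real x t v 2∣t∣<∣v∣) ⟩
    hurwitzTail f (p -ᵍ (real x *ᵍ real v)) (real v)
      ≡⟨ cong (λ w → hurwitzTail f w (real v)) (real-cancel t x v) ⟩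
    hurwitzTail f (real t) (real v) ∎
    where
    open ≡-Reasoning
    p = real (t + x * v)

  hurwitzTail-real : ∀ {f ds} u x v → 2 ℕ.* ∣ u ∣ < ∣ v ∣ →
    hurwitzTail f (real u) (real v) ≡ just ds →
    hurwitzTail (suc f) (real v) (real (u + x * v)) ≡ just (real x ∷ ds)
  hurwitzTail-real {f} {ds} u x v 2∣u∣<∣v∣ tail = begin
    hurwitzTail (suc f) (real v) (real (u + x * v)) ≡⟨ hurwitzTail-step v≢0 tail′ ⟩
    just (nearest (real (u + x * v)) (real v) ∷ ds) ≡⟨ cong (λ a → just (a ∷ ds)) near ⟩
    just (real x ∷ ds)                              ∎
    where
    open ≡-Reasoning
    near = nearest-real x u v 2∣u∣<∣v∣
    v≢0 : v ≢ 0ℤ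
    v≢0 v≡0 = ℕ.<⇒≢ (ℕ.≤-<-trans z≤n 2∣u∣<∣v∣) (sym (cong ∣_∣ v≡0))
    tail′ = trans (hurwitzDigits-real f u x v 2∣u∣<∣v∣) tail

  TwoFifths : ℤ → ℤ → Set
  TwoFifths b d = 5 ℕ.* ∣ b ∣ ≤ 2 ℕ.* ∣ d ∣ × 0 < ∣ d ∣

  twoFifths⇒half : ∀ B D → 5 ℕ.* B ≤ 2 ℕ.* D → 0 < D → 2 ℕ.* B < D
  twoFifths⇒half B D 5B≤2D 0<D = ℕ.*-cancelˡ-< 5 _ _ (begin-strict
    5 ℕ.* (2 ℕ.* B)       ≡⟨ ℕ.solve (B ∷ []) ⟩
    2 ℕ.* (5 ℕ.* B)       ≤⟨ ℕ.*-monoʳ-≤ 2 5B≤2D ⟩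
    2 ℕ.* (2 ℕ.* D)       <⟨ ℕ.m<m+n _ 0<D ⟩
    2 ℕ.* (2 ℕ.* D) ℕ.+ D ≡⟨ ℕ.solve (D ∷ []) ⟩
    5 ℕ.* D               ∎)
    where open ℕ.≤-Reasoning

  -- If |b / d| ≤ 2/5 and |x| ≥ 3 then |x + b / d| ≥ 3 - 2/5 ≥ 5/2.
  twoFifths-invert : ∀ B D V → 5 ℕ.* B ≤ 2 ℕ.* D → 3 ℕ.* D ≤ V ℕ.+ B → 5 ℕ.* D ≤ 2 ℕ.* V
  twoFifths-invert B D V 5B≤2D 3D≤V+B = ℕ.+-cancelʳ-≤ D _ _ (begin
    5 ℕ.* D ℕ.+ D       ≡⟨ ℕ.solve (D ∷ []) ⟩
    2 ℕ.* (3 ℕ.* D)     ≤⟨ ℕ.*-monoʳ-≤ 2 3D≤V+B ⟩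
    2 ℕ.* (V ℕ.+ B)     ≡⟨ ℕ.*-distribˡ-+ 2 V B ⟩
    2 ℕ.* V ℕ.+ 2 ℕ.* B ≤⟨ ℕ.+-monoʳ-≤ (2 ℕ.* V) 2B≤D ⟩
    2 ℕ.* V ℕ.+ D       ∎)
    where
    open ℕ.≤-Reasoning
    2B≤D : 2 ℕ.* B ≤ D
    2B≤D = ℕ.*-cancelˡ-≤ 2 (begin
      2 ℕ.* (2 ℕ.* B) ≡⟨ ℕ.solve (B ∷ []) ⟩
      4 ℕ.* B         ≤⟨ ℕ.*-monoˡ-≤ B (ℕ.n≤1+n 4) ⟩
      5 ℕ.* B         ≤⟨ 5B≤2D ⟩
      2 ℕ.* D         ∎)

  twoFifths-◂ : ∀ x M → 3 ≤ ∣ x ∣ → TwoFifths (Mat.b M) (Mat.d M) →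
                TwoFifths (Mat.b (x ◂ M)) (Mat.d (x ◂ M))
  twoFifths-◂ x (mk _ b _ d) 3≤∣x∣ (5B≤2D , 0<D) = 5D≤2V , 0<V
    where
    open ℕ.≤-Reasoning
    xd≡V-b : x * d ≡ (b + x * d) - b
    xd≡V-b = solve (x ∷ b ∷ d ∷ [])
    3D≤V+B : 3 ℕ.* ∣ d ∣ ≤ ∣ b + x * d ∣ ℕ.+ ∣ b ∣
    3D≤V+B = begin
      3 ℕ.* ∣ d ∣             ≤⟨ ℕ.*-monoˡ-≤ ∣ d ∣ 3≤∣x∣ ⟩
      ∣ x ∣ ℕ.* ∣ d ∣         ≡⟨ ℤ.abs-* x d ⟨
      ∣ x * d ∣               ≡⟨ cong ∣_∣ xd≡V-b ⟩
      ∣ (b + x * d) - b ∣     ≤⟨ ℤ.∣i-j∣≤∣i∣+∣j∣ (b + x * d) b ⟩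
      ∣ b + x * d ∣ ℕ.+ ∣ b ∣ ∎
    5D≤2V = twoFifths-invert (∣ b ∣) (∣ d ∣) (∣ b + x * d ∣) 5B≤2D 3D≤V+B
    0<V = ℕ.*-cancelˡ-< 2 0 _ (ℕ.<-≤-trans (ℕ.*-monoʳ-< 5 0<D) 5D≤2V)

  ∣c*i∣≡∣i∣ : ∀ c i → ∣ c ∣ ≡ 1 → ∣ c * i ∣ ≡ ∣ i ∣
  ∣c*i∣≡∣i∣ c i ∣c∣≡1 =
    trans (ℤ.abs-* c i) (trans (cong (ℕ._* ∣ i ∣) ∣c∣≡1) (ℕ.*-identityˡ ∣ i ∣))

  hurwitzTail-◂ : ∀ {f ds} c x M → ∣ c ∣ ≡ 1 → TwoFifths (Mat.b M) (Mat.d M) →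
    hurwitzTail f (real (c * Mat.b M)) (real (c * Mat.d M)) ≡ just ds →
    hurwitzTail (suc f) (real (c * Mat.b (x ◂ M))) (real (c * Mat.d (x ◂ M))) ≡ just (real x ∷ ds)
  hurwitzTail-◂ {f} {ds} c x (mk _ b _ d) ∣c∣≡1 (5B≤2D , 0<D) tail =
    subst (λ w → hurwitzTail (suc f) (real (c * d)) (real w) ≡ just (real x ∷ ds)) (sym distrib)
      (hurwitzTail-real (c * b) x (c * d) 2∣cb∣<∣cd∣ tail)
    where
    distrib : c * (b + x * d) ≡ c * b + x * (c * d)
    distrib = solve (c ∷ b ∷ x ∷ d ∷ [])
    2∣cb∣<∣cd∣ : 2 ℕ.* ∣ c * b ∣ < ∣ c * d ∣
    2∣cb∣<∣cd∣ = subst₂ (λ m n → 2 ℕ.* m < n) (sym (∣c*i∣≡∣i∣ c b ∣c∣≡1)) (sym (∣c*i∣≡∣i∣ c d ∣c∣≡1))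
      (twoFifths⇒half (∣ b ∣) (∣ d ∣) 5B≤2D 0<D)

  -- Residues and coprimality

  sign-unit : ∀ i → ∃ λ c → ∣ c ∣ ≡ 1 × c * i ≡ + ∣ i ∣
  sign-unit (+ n)    = 1ℤ , refl , ℤ.*-identityˡ (+ n)
  sign-unit -[1+ n ] = -1ℤ , refl , ℤ.*-identityˡ (+ suc n)

  positive-residue : ∀ t Q → 0 < ∣ t ∣ → ∣ t ∣ < Q →
                     ∃₂ λ a x → 1 ≤ a × a < Q × + a ≡ t + x * + Q
  positive-residue (+ a)    Q 0<a a<Q = a , 0ℤ , 0<a , a<Q , sym (ℤ.+-identityʳ (+ a))
  positive-residue -[1+ n ] Q _   n<Q =
    Q ℕ.∸ suc n , 1ℤ , ℕ.m<n⇒0<n∸m n<Q , ℕ.∸-monoʳ-< ℕ.z<s (ℕ.<⇒≤ n<Q) ,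
    trans (sym (ℤ.⊖-≥ (ℕ.<⇒≤ n<Q))) (cong (λ y → -[1+ n ] + y) (sym (ℤ.*-identityˡ (+ Q))))

  ∣column⇒∣det : ∀ {p} c M → p ℤ.∣ c * Mat.b M → p ℤ.∣ c * Mat.d M → p ℤ.∣ c * det M
  ∣column⇒∣det {p} c (mk a b γ d) p∣cb p∣cd =
    subst (p ℤ.∣_) expand (ℤ.∣m∣n⇒∣m-n (ℤ.∣n⇒∣m*n a p∣cd) (ℤ.∣m⇒∣m*n γ p∣cb))
    where
    expand : a * (c * d) - c * b * γ ≡ c * (a * d - b * γ)
    expand = solve (c ∷ a ∷ b ∷ γ ∷ d ∷ [])

  coprime-column : ∀ {a Q} c y M → ∣ c ∣ ≡ 1 → ∣ det M ∣ ≡ 1 →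
                   c * Mat.d M ≡ + Q → + a ≡ c * Mat.b M + y * + Q → Coprime a Q
  coprime-column {a} {Q} c y M ∣c∣≡1 ∣detM∣≡1 cd≡Q a≡ {p} (p∣a , p∣Q) =
    ℕ.∣1⇒≡1 (subst (p ℕ.∣_) ∣c*detM∣≡1 (ℤ.∣⇒∣ᵤ (∣column⇒∣det c M p∣cb p∣cd)))
    where
    +p∣+Q : + p ℤ.∣ + Q
    +p∣+Q = ℤ.∣ᵤ⇒∣ p∣Q
    p∣cb : + p ℤ.∣ c * Mat.b M
    p∣cb = ℤ.∣m+n∣n⇒∣m (subst (+ p ℤ.∣_) a≡ (ℤ.∣ᵤ⇒∣ p∣a)) (ℤ.∣n⇒∣m*n y +p∣+Q)
    p∣cd : + p ℤ.∣ c * Mat.d M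
    p∣cd = subst (+ p ℤ.∣_) (sym cd≡Q) +p∣+Q
    ∣c*detM∣≡1 : ∣ c * det M ∣ ≡ 1
    ∣c*detM∣≡1 = trans (∣c*i∣≡∣i∣ c (det M) ∣c∣≡1) ∣detM∣≡1

  -- Bounded digits

  Bounded : ℕ → ℕ → ℤ → Set
  Bounded lo hi x = lo ≤ ∣ x ∣ × ∣ x ∣ ≤ hi

  bounded? : ∀ lo hi x → Dec (Bounded lo hi x)
  bounded? lo hi x = lo ℕ.≤? ∣ x ∣ ×-dec ∣ x ∣ ℕ.≤? hi

  Bounded-neg : ∀ {lo hi} x → Bounded lo hi x → Bounded lo hi (- x)
  Bounded-neg {lo} {hi} x = subst (λ n → lo ≤ n × n ≤ hi) (sym (ℤ.∣-i∣≡∣i∣ x))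

  Bounded-shift : ∀ {lo hi} x y → ∣ y ∣ ≡ 1 → Bounded (suc lo) hi x → Bounded lo (suc hi) (x + y)
  Bounded-shift {lo} {hi} x y ∣y∣≡1 (lo<∣x∣ , ∣x∣≤hi) = lower , upper
    where
    open ℕ.≤-Reasoning
    x≡x+y-y : x ≡ (x + y) - y
    x≡x+y-y = solve (x ∷ y ∷ [])
    lower : lo ≤ ∣ x + y ∣
    lower = ℕ.s≤s⁻¹ (begin
      suc lo              ≤⟨ lo<∣x∣ ⟩
      ∣ x ∣               ≡⟨ cong ∣_∣ x≡x+y-y ⟩
      ∣ (x + y) - y ∣     ≤⟨ ℤ.∣i-j∣≤∣i∣+∣j∣ (x + y) y ⟩
      ∣ x + y ∣ ℕ.+ ∣ y ∣ ≡⟨ cong (∣ x + y ∣ ℕ.+_) ∣y∣≡1 ⟩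
      ∣ x + y ∣ ℕ.+ 1     ≡⟨ ℕ.+-comm ∣ x + y ∣ 1 ⟩
      suc ∣ x + y ∣       ∎)
    upper : ∣ x + y ∣ ≤ suc hi
    upper = begin
      ∣ x + y ∣           ≤⟨ ℤ.∣i+j∣≤∣i∣+∣j∣ x y ⟩
      ∣ x ∣ ℕ.+ ∣ y ∣     ≡⟨ cong (∣ x ∣ ℕ.+_) ∣y∣≡1 ⟩
      ∣ x ∣ ℕ.+ 1         ≡⟨ ℕ.+-comm ∣ x ∣ 1 ⟩
      suc ∣ x ∣           ≤⟨ s≤s ∣x∣≤hi ⟩
      suc hi              ∎

  norm-real-bounded : ∀ {lo hi x} → Bounded lo hi x → norm (real x) ≤ hi ℕ.* hi
  norm-real-bounded {hi = hi} {x} (_ , ∣x∣≤hi) =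
    subst (_≤ hi ℕ.* hi) (sym (ℕ.+-identityʳ (∣ x ∣ ℕ.* ∣ x ∣))) (ℕ.*-mono-≤ ∣x∣≤hi ∣x∣≤hi)


module DigitStrings where

  open import Data.Integer.Base using (ℤ; +_; 1ℤ; -1ℤ; _+_; _-_; _*_; -_; ∣_∣)
  import Data.Integer.Properties as ℤ
  open import Data.List.Base using (List; []; _∷_; _++_; [_]; length; map)
  open import Data.List.Properties using (++-conicalʳ)
  open import Data.List.Relation.Unary.All using (All; []; _∷_)
  import Data.List.Relation.Unary.All.Properties as All
  open import Data.Maybe.Base using (just)
  open import Data.Nat.Base as ℕ using (ℕ; suc; _≤_; _<_; _^_; z≤n; s≤s)
  import Data.Nat.Properties as ℕ
  open import Data.Nat.Binary.Base as ℕᵇ using (ℕᵇ; 2[1+_]; 1+[2_]; toℕ; fromℕ)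
  open import Data.Nat.Binary.Properties using (toℕ-fromℕ)
  open import Data.Nat.Coprimality using (Coprime)
  open import Data.Product.Base using (∃; ∃₂; _×_; _,_; proj₁; proj₂)
  open import Function.Base using (_∘_)
  open import Relation.Binary.PropositionalEquality
    using (_≡_; refl; sym; trans; cong; cong₂; subst; subst₂; module ≡-Reasoning)
  open import Relation.Nullary.Decidable using (from-yes)
  open import Relation.Nullary.Negation using (contradiction)
  open import Defs
  open Continuants

  Digit : ℤ → Set
  Digit = Bounded 3 7

  lastOf : ℤ → List ℤ → ℤ
  lastOf x []      = x
  lastOf _ (y ∷ D) = lastOf y D

  lastOf-++-[y] : ∀ x D y → lastOf x (D ++ [ y ]) ≡ y
  lastOf-++-[y] x []      y = refl
  lastOf-++-[y] x (z ∷ D) y = lastOf-++-[y] z D y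

  all-fold₅ : ∀ {D} → All Digit D → All Digit (fold₅ D)
  all-fold₅ {[]}    []        = from-yes (bounded? 3 7 (+ 5)) ∷ []
  all-fold₅ {x ∷ _} (dx ∷ dD) = dx ∷ All.++⁺ (all-fold₅ dD) (Bounded-neg x dx ∷ [])

  all-foldEven : ∀ x D → All Digit (x ∷ D) → Bounded 4 6 (lastOf x D) →
                 All Digit (foldEven x D)
  all-foldEven x []      _         end =
    Bounded-shift x 1ℤ refl end ∷ Bounded-shift x -1ℤ refl end ∷ []
  all-foldEven x (y ∷ D) (dx ∷ dD) end = dx ∷ All.++⁺ (all-foldEven y D dD end) (dx ∷ [])

  ^-double : ∀ m k → m ^ k ℕ.* m ^ k ≡ m ^ (2 ℕ.* k)
  ^-double m k =
    trans (sym (ℕ.^-distribˡ-+-* m k k)) (cong (λ n → m ^ (k ℕ.+ n)) (sym (ℕ.+-identityʳ k)))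

  ∣d∣-fold₅ : ∀ k D → ∣ Mat.d (mat D) ∣ ≡ 5 ^ k →
              ∣ Mat.d (mat (fold₅ D)) ∣ ≡ 5 ^ suc (2 ℕ.* k)
  ∣d∣-fold₅ k D ∣d∣≡5^k = begin
    ∣ Mat.d (mat (fold₅ D)) ∣       ≡⟨ cong (λ N → ∣ Mat.d N ∣) (mat-fold₅ D) ⟩
    ∣ Mat.d (fold₅Mat (det M) M) ∣  ≡⟨ cong ∣_∣ (fold₅Mat-d (det M) M) ⟩
    ∣ det M * (+ 5 * (d * d)) ∣     ≡⟨ ℤ.abs-* (det M) (+ 5 * (d * d)) ⟩
    ∣ det M ∣ ℕ.* ∣ + 5 * (d * d) ∣ ≡⟨ cong₂ ℕ._*_ (∣det-mat∣ D) (ℤ.abs-* (+ 5) (d * d)) ⟩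
    1 ℕ.* (5 ℕ.* ∣ d * d ∣)         ≡⟨ ℕ.*-identityˡ _ ⟩
    5 ℕ.* ∣ d * d ∣                 ≡⟨ cong (5 ℕ.*_) (ℤ.abs-* d d) ⟩
    5 ℕ.* (∣ d ∣ ℕ.* ∣ d ∣)         ≡⟨ cong (λ n → 5 ℕ.* (n ℕ.* n)) ∣d∣≡5^k ⟩
    5 ℕ.* (5 ^ k ℕ.* 5 ^ k)         ≡⟨ cong (5 ℕ.*_) (^-double 5 k) ⟩
    5 ^ suc (2 ℕ.* k)               ∎
    where
    open ≡-Reasoning
    M = mat D
    d = Mat.d M

  ∣d∣-foldEven : ∀ k x D → ∣ Mat.d (mat (x ∷ D)) ∣ ≡ 5 ^ k →
                 ∣ Mat.d (mat (foldEven x D)) ∣ ≡ 5 ^ (2 ℕ.* k)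
  ∣d∣-foldEven k x D ∣d∣≡5^k = begin
    ∣ Mat.d (mat (foldEven x D)) ∣    ≡⟨ cong (λ N → ∣ Mat.d N ∣) (mat-foldEven x D) ⟩
    ∣ Mat.d (foldEvenMat (det M) M) ∣ ≡⟨ cong ∣_∣ (foldEvenMat-d (det M) M) ⟩
    ∣ d * d ∣                         ≡⟨ ℤ.abs-* d d ⟩
    ∣ d ∣ ℕ.* ∣ d ∣                   ≡⟨ cong (λ n → n ℕ.* n) ∣d∣≡5^k ⟩
    5 ^ k ℕ.* 5 ^ k                   ≡⟨ ^-double 5 k ⟩
    5 ^ (2 ℕ.* k)                     ∎
    where
    open ≡-Reasoning
    M = mat (x ∷ D)
    d = Mat.d M

  -- The folds keep all digits in [3, 7] as long as the outer digits lie in [4, 6];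
  -- a single digit has to be ±5 since foldEven changes it.
  record DigitString (k : ℕ) : Set where
    constructor digitString
    field
      first         : ℤ
      rest          : List ℤ
      digits        : All Digit (first ∷ rest)
      first-bounded : Bounded 4 6 first
      last-bounded  : Bounded 4 6 (lastOf first rest)
      singleton     : rest ≡ [] → Bounded 5 5 first
      denominator   : ∣ Mat.d (mat (first ∷ rest)) ∣ ≡ 5 ^ k

  five : DigitString 1
  five = digitString (+ 5) [] (from-yes (bounded? 3 7 (+ 5)) ∷ [])
    (from-yes (bounded? 4 6 (+ 5))) (from-yes (bounded? 4 6 (+ 5)))
    (λ _ → from-yes (bounded? 5 5 (+ 5))) refl

  fold₅-step : ∀ {k} → DigitString k → DigitString (suc (2 ℕ.* k))
  fold₅-step {k} (digitString x D ds xb _ _ ∣d∣≡5^k) =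
    digitString x (fold₅ D ++ [ - x ]) (all-fold₅ ds) xb
      (subst (Bounded 4 6) (sym (lastOf-++-[y] x (fold₅ D) (- x))) (Bounded-neg x xb))
      (λ empty → contradiction (++-conicalʳ (fold₅ D) _ empty) λ ())
      (∣d∣-fold₅ k (x ∷ D) ∣d∣≡5^k)

  foldEven-step : ∀ {k} → DigitString k → DigitString (2 ℕ.* k)
  foldEven-step {k} (digitString x [] ds _ lb singleton ∣d∣≡5^k) =
    digitString (x + 1ℤ) [ x - 1ℤ ] (all-foldEven x [] ds lb)
      (Bounded-shift x 1ℤ refl (singleton refl)) (Bounded-shift x -1ℤ refl (singleton refl))
      (λ ()) (∣d∣-foldEven k x [] ∣d∣≡5^k)
  foldEven-step {k} (digitString x (y ∷ D) ds xb lb _ ∣d∣≡5^k) =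
    digitString x (foldEven y D ++ [ x ]) (all-foldEven x (y ∷ D) ds lb) xb
      (subst (Bounded 4 6) (sym (lastOf-++-[y] x (foldEven y D) x)) xb)
      (λ empty → contradiction (++-conicalʳ (foldEven y D) _ empty) λ ())
      (∣d∣-foldEven k x (y ∷ D) ∣d∣≡5^k)

  digitStringᵇ : (n : ℕᵇ) → DigitString (suc (toℕ n))
  digitStringᵇ ℕᵇ.zero = five
  digitStringᵇ 2[1+ n ] = fold₅-step (digitStringᵇ n)
  digitStringᵇ 1+[2 n ] = subst DigitString (ℕ.*-suc 2 (toℕ n)) (foldEven-step (digitStringᵇ n))

  digitStrings : ∀ k → DigitString (suc k)
  digitStrings k = subst (DigitString ∘ suc) (toℕ-fromℕ k) (digitStringᵇ (fromℕ k))

  twoFifths-mat : ∀ {D} → All (λ x → 3 ≤ ∣ x ∣) D → TwoFifths (Mat.b (mat D)) (Mat.d (mat D))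
  twoFifths-mat         []              = z≤n , s≤s z≤n
  twoFifths-mat {x ∷ D} (3≤∣x∣ ∷ bigs) = twoFifths-◂ x (mat D) 3≤∣x∣ (twoFifths-mat bigs)

  hurwitzTail-mat : ∀ c {D} → ∣ c ∣ ≡ 1 → All (λ x → 3 ≤ ∣ x ∣) D →
    hurwitzTail (length D) (real (c * Mat.b (mat D))) (real (c * Mat.d (mat D)))
      ≡ just (map real D)
  hurwitzTail-mat c _ [] rewrite ℤ.*-zeroʳ c = refl
  hurwitzTail-mat c {x ∷ D} ∣c∣≡1 (3≤∣x∣ ∷ bigs) =
    hurwitzTail-◂ c x (mat D) ∣c∣≡1 (twoFifths-mat bigs) (hurwitzTail-mat c ∣c∣≡1 bigs)

  Expansion : ℕ → List ℤ → Set
  Expansion Q D = ∃ λ a → 1 ≤ a × a < Q × Coprime a Q ×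
                          hurwitzDigits (length D) (ofℕ a) (ofℕ Q) ≡ just (map real D)

  expansion-signed : ∀ {Q} c x D → ∣ c ∣ ≡ 1 → c * Mat.d (mat (x ∷ D)) ≡ + Q →
                     All (λ y → 3 ≤ ∣ y ∣) (x ∷ D) → Expansion Q (x ∷ D)
  expansion-signed {Q} c x D ∣c∣≡1 cd≡Q bigs@(_ ∷ bigsD) =
    conclude (positive-residue t Q 0<∣t∣ ∣t∣<Q)
    where
    open ≡-Reasoning
    M = mat (x ∷ D)
    t = c * Mat.b M
    n = length (x ∷ D)
    ∣t∣≡∣b∣ = ∣c*i∣≡∣i∣ c (Mat.b M) ∣c∣≡1
    ∣cd∣≡Q = trans (sym (∣c*i∣≡∣i∣ c (Mat.d M) ∣c∣≡1)) (cong ∣_∣ cd≡Q)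
    bound = twoFifths-mat bigs
    2∣t∣<Q : 2 ℕ.* ∣ t ∣ < Q
    2∣t∣<Q = subst₂ (λ m q → 2 ℕ.* m < q) (sym ∣t∣≡∣b∣) ∣cd∣≡Q
      (twoFifths⇒half ∣ Mat.b M ∣ ∣ Mat.d M ∣ (proj₁ bound) (proj₂ bound))
    ∣t∣<Q : ∣ t ∣ < Q
    ∣t∣<Q = ℕ.≤-<-trans (ℕ.m≤m+n ∣ t ∣ (∣ t ∣ ℕ.+ 0)) 2∣t∣<Q
    0<∣t∣ : 0 < ∣ t ∣
    0<∣t∣ = subst (0 <_) (sym (trans ∣t∣≡∣b∣ (cong ∣_∣ (◂-b x (mat D)))))
      (proj₂ (twoFifths-mat bigsD))
    conclude : (∃₂ λ a y → 1 ≤ a × a < Q × + a ≡ t + y * + Q) → Expansion Q (x ∷ D)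
    conclude (a , y , 1≤a , a<Q , a≡) =
      a , 1≤a , a<Q , coprime-column c y M ∣c∣≡1 (∣det-mat∣ (x ∷ D)) cd≡Q a≡ , (begin
        hurwitzDigits n (real (+ a)) (real (+ Q))
          ≡⟨ cong (λ w → hurwitzDigits n (real w) (real (+ Q))) a≡ ⟩
        hurwitzDigits n (real (t + y * + Q)) (real (+ Q))
          ≡⟨ hurwitzDigits-real n t y (+ Q) 2∣t∣<Q ⟩
        hurwitzTail n (real t) (real (+ Q))
          ≡⟨ cong (λ w → hurwitzTail n (real t) (real w)) cd≡Q ⟨
        hurwitzTail n (real t) (real (c * Mat.d M))
          ≡⟨ hurwitzTail-mat c ∣c∣≡1 bigs ⟩
        just (map real (x ∷ D)) ∎)

  expansion : ∀ {Q} x D → All (λ y → 3 ≤ ∣ y ∣) (x ∷ D) → ∣ Mat.d (mat (x ∷ D)) ∣ ≡ Q →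
              Expansion Q (x ∷ D)
  expansion x D bigs refl = let (c , ∣c∣≡1 , cd≡∣d∣) = sign-unit (Mat.d (mat (x ∷ D))) in
    expansion-signed c x D ∣c∣≡1 cd≡∣d∣ bigs

open import Defs
open import Data.Nat using (ℕ; _≤_; _<_; _^_; _*_)
open import Data.Nat.GCD using (gcd)
open import Data.Product using (Σ; _×_; ∃)
open import Data.List using (List)
open import Data.List.Relation.Unary.All using (All)
open import Data.Maybe using (just)
open import Relation.Binary.PropositionalEquality using (_≡_)
open import Data.List using (_∷_; length; map)
import Data.List.Relation.Unary.All as All
import Data.List.Relation.Unary.All.Properties as All
open import Data.Nat using (suc)
open import Data.Nat.Coprimality using (coprime⇒gcd≡1)
open import Data.Nat.Divisibility using (∣-trans; m∣m*n)
open import Data.Product using (_,_; proj₁)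
open Continuants using (real; norm-real-bounded)
open DigitStrings using (module DigitString; digitStrings; expansion)

theorem5p7 : (k : ℕ) → 1 ≤ k →
  Σ ℕ (λ a → 1 ≤ a × a < 5 ^ k × gcd a 5 ≡ 1 ×
    Σ ℕ (λ fuel → Σ (List ℤ[i]) (λ ds →
      hurwitzDigits fuel (ofℕ a) (ofℕ (5 ^ k)) ≡ just ds ×
      All (λ d → norm d ≤ 7 * 7) ds)))
theorem5p7 (suc k) _ =
  let open DigitString (digitStrings k)
      D = first ∷ rest
      (a , 1≤a , a<5^k , coprime , expands) =
        expansion first rest (All.map proj₁ digits) denominator
  in  a , 1≤a , a<5^k ,
      coprime⇒gcd≡1 (λ (p∣a , p∣5) → coprime (p∣a , ∣-trans p∣5 (m∣m*n (5 ^ k)))) ,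
      length D , map real D , expands ,
      All.map⁺ (All.map (λ {y} → norm-real-bounded {x = y}) digits)
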